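{- Let $(E,w,d)$ be a full ultra triple, let $C\subseteq E$, let $m$ be a nonnegative integer, and let $k\in\{1,\ldots,m\}$. Then the number $w(c_k)+\sum_{i=1}^{k-1}d(c_i,c_k)$ is the same for every greedy $m$-subsequence $(c_1,\ldots,c_m)$ of $C$ (it depends only on $k$ and $C$).
   Context: A full ultra triple $(E,w,d)$ consists of a set $E$, a function $w:E\to\mathbb{R}$, and a function $d:E\times E\to\mathbb{R}$ such that $d(a,b)=d(b,a)$ for all $a,b\in E$ and $d(a,b)\le\max\{d(a,c),d(b,c)\}$ for all $a,b,c\in E$. An $m$-subsequence of $C$ is an $m$-tuple of (not necessarily distinct) elements of $C$. The perimeter of $(a_1,\ldots,a_m)\in E^m$ is $\operatorname{PER}(a_1,\ldots,a_m)=\sum_{k=1}^m w(a_k)+\sum_{1\le i<j\le m}d(a_i,a_j)$. A greedy $m$-subsequence of $C$ is an $m$-subsequence $(c_1,\ldots,c_m)$ of $C$ such that for each $i\in\{1,\ldots,m\}$ and each $x\in C$, $\operatorname{PER}(c_1,\ldots,c_i)\ge\operatorname{PER}(c_1,\ldots,c_{i-1},x)$. -}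

module Defs where

open import Level using (0ℓ)
open import Data.Empty using (⊥)
open import Data.Nat using (ℕ; suc)
open import Data.Fin using (Fin; toℕ)
open import Data.Product using (Σ; _×_)
open import Data.Sum using (_⊎_)
open import Data.List using (List; []; _∷_; _++_; [_]; take; foldr; map)
open import Data.Vec using (Vec; toList; lookup)
open import Relation.Binary.PropositionalEquality using (_≡_)
open import Relation.Binary.Structures using (IsTotalOrder)
open import Algebra.Structures using (IsCommutativeRing)

-- The real numbers, axiomatised as a Dedekind-complete ordered field.
-- (Any two such structures are isomorphic, so quantifying over all of
-- them is the same as working with ℝ.)

record RealField : Set₁ where
  infixl 6 _+_
  infixl 7 _*_
  infix  4 _≤_
  field
    ℝ   : Set
    _+_ : ℝ → ℝ → ℝ
    _*_ : ℝ → ℝ → ℝ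
    -_  : ℝ → ℝ
    0ℝ  : ℝ
    1ℝ  : ℝ
    _≤_ : ℝ → ℝ → Set
    isCommutativeRing : IsCommutativeRing _≡_ _+_ _*_ -_ 0ℝ 1ℝ
    0≢1 : 0ℝ ≡ 1ℝ → ⊥
    inverse : ∀ x → (x ≡ 0ℝ → ⊥) → Σ ℝ (λ y → x * y ≡ 1ℝ)
    isTotalOrder : IsTotalOrder _≡_ _≤_
    +-mono-≤ : ∀ {x y} z → x ≤ y → x + z ≤ y + z
    *-nonneg : ∀ {x y} → 0ℝ ≤ x → 0ℝ ≤ y → 0ℝ ≤ x * y
    complete : (S : ℝ → Set) → Σ ℝ S →
               Σ ℝ (λ b → ∀ x → S x → x ≤ b) →
               Σ ℝ (λ s → (∀ x → S x → x ≤ s) ×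
                          (∀ b → (∀ x → S x → x ≤ b) → s ≤ b))

-- Full ultra triples (E, w, d) with values in a real field R.
-- d(a,b) ≤ max{d(a,c), d(b,c)} is written as
-- d(a,b) ≤ d(a,c) or d(a,b) ≤ d(b,c)  (equivalent for a total order).

record FullUltraTriple (R : RealField) : Set₁ where
  open RealField R
  field
    E     : Set
    w     : E → ℝ
    d     : E → E → ℝ
    d-sym : ∀ a b → d a b ≡ d b a
    d-ultra : ∀ a b c → (d a b ≤ d a c) ⊎ (d a b ≤ d b c)

module _ {R : RealField} (T : FullUltraTriple R) where
  open RealField R
  open FullUltraTriple T

  sumℝ : List ℝ → ℝ
  sumℝ = foldr _+_ 0ℝ

  -- Perimeter of a finite sequence (a₁,…,aₘ):
  --   Σₖ w(aₖ) + Σ_{i<j} d(aᵢ,aⱼ)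
  PER : List E → ℝ
  PER []       = 0ℝ
  PER (a ∷ as) = w a + sumℝ (map (d a) as) + PER as

  prefix : ∀ {m} → Vec E m → ℕ → List E
  prefix c n = take n (toList c)

  -- greedy m-subsequence of C (indices 0-based: i : Fin m stands for i+1)
  IsGreedy : (C : E → Set) (m : ℕ) → Vec E m → Set
  IsGreedy C m c =
    (∀ (i : Fin m) → C (lookup c i)) ×
    (∀ (i : Fin m) (x : E) → C x →
       PER (prefix c (toℕ i) ++ [ x ]) ≤ PER (prefix c (suc (toℕ i))))

  -- w(c_k) + Σ_{i<k} d(c_i, c_k)   (k : Fin m is the paper's k-1)
  gain : ∀ {m} → Vec E m → Fin m → ℝ
  gain c k = w (lookup c k) + sumℝ (map (λ y → d y (lookup c k)) (prefix c (toℕ k)))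

module Submission where

-- Greedy sequences in a full ultra triple maximise the perimeter, hence all
-- greedy m-subsequences of C have the same prefix perimeters, and the gain of
-- the k-th step, being the difference of two consecutive prefix perimeters, is
-- the same for all of them.
--
-- The key observation is that choosing a point a turns the remaining problem
-- into the same problem with the weight v replaced by v + d(a,·).  We therefore
-- work with the perimeter for an arbitrary weight v (the triple T with w := v)
-- and with a recursive, list-based notion of greedy sequence.  Maximality
-- (greedy-maximal) is proved by induction: from a competing sequence x remove
-- the point b closest to the greedy head a; by the ultrametric inequality b is
-- no farther from every other point of x than a is, so replacing b by a cannot
-- decrease the perimeter, and the rest is the induction hypothesis for the
-- shifted weight.

open import Level using (0ℓ)
open import Data.Nat using (ℕ; zero; suc; _⊓_)
open import Data.Nat.Properties using (suc-injective)
open import Data.Fin as Fin using (Fin; toℕ)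
open import Data.Vec using (Vec; []; _∷_; toList; lookup)
open import Data.Vec.Properties using (length-toList)
open import Data.Vec.Relation.Unary.All.Properties using (lookup⁻; toList⁺)
open import Data.List using (List; []; _∷_; _++_; [_]; take; map; length)
open import Data.List.Properties using (++-identityʳ; map-cong; length-take)
open import Data.List.Relation.Unary.All as All using (All; []; _∷_)
open import Data.List.Relation.Unary.All.Properties using (++⁺; ++⁻; take⁺)
open import Data.Product using (_×_; _,_; proj₁; proj₂)
open import Data.Sum using (inj₁; inj₂)
open import Data.Unit using (⊤; tt)
open import Relation.Binary.PropositionalEquality
  using (_≡_; refl; sym; trans; cong; cong₂; subst; subst₂; module ≡-Reasoning)
open import Relation.Binary.Bundles using (Poset)
open import Relation.Binary.Structures using (IsTotalOrder)
open import Algebra.Structures using (IsCommutativeRing)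
open import Algebra.Bundles using (CommutativeMonoid)
import Algebra.Solver.CommutativeMonoid as CommutativeMonoidSolver
import Relation.Binary.Reasoning.PartialOrder as PosetReasoning
open import Defs

module OrderedAddition (R : RealField) where
  open RealField R
  open IsCommutativeRing isCommutativeRing using (+-assoc; +-comm; +-identityʳ; -‿inverseʳ)
  open IsTotalOrder isTotalOrder using () renaming (trans to ≤-trans)

  +-monoʳ-≤ : ∀ {x y} z → x ≤ y → z + x ≤ z + y
  +-monoʳ-≤ {x} {y} z x≤y = subst₂ _≤_ (+-comm x z) (+-comm y z) (+-mono-≤ z x≤y)

  +-mono₂-≤ : ∀ {x y u v} → x ≤ y → u ≤ v → x + u ≤ y + v
  +-mono₂-≤ {y = y} {u = u} x≤y u≤v = ≤-trans (+-mono-≤ u x≤y) (+-monoʳ-≤ y u≤v)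

  +-undo : ∀ u y → u + y + - u ≡ y
  +-undo u y = begin
      u + y + - u   ≡⟨ cong (_+ - u) (+-comm u y) ⟩
      y + u + - u   ≡⟨ +-assoc y u (- u) ⟩
      y + (u + - u) ≡⟨ cong (y +_) (-‿inverseʳ u) ⟩
      y + 0ℝ        ≡⟨ +-identityʳ y ⟩
      y             ∎
    where open ≡-Reasoning

  +-cancelˡ-≤ : ∀ u {y z} → u + y ≤ u + z → y ≤ z
  +-cancelˡ-≤ u {y} {z} h = subst₂ _≤_ (+-undo u y) (+-undo u z) (+-mono-≤ (- u) h)

  +-cancelˡ-≡ : ∀ u {y z} → u + y ≡ u + z → y ≡ z
  +-cancelˡ-≡ u {y} {z} h = trans (sym (+-undo u y)) (trans (cong (_+ - u) h) (+-undo u z))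

module GreedyPerimeter (R : RealField) (T : FullUltraTriple R) where
  open RealField R
  open FullUltraTriple T
  open OrderedAddition R
  open IsCommutativeRing isCommutativeRing
    using (+-assoc; +-comm; +-identityˡ; +-identityʳ; +-isCommutativeMonoid)
  open IsTotalOrder isTotalOrder
    using (total; reflexive; isPartialOrder) renaming (trans to ≤-trans; antisym to ≤-antisym)

  ℝ-poset : Poset 0ℓ 0ℓ 0ℓ
  ℝ-poset = record { Carrier = ℝ ; _≈_ = _≡_ ; _≤_ = _≤_ ; isPartialOrder = isPartialOrder }

  ℝ-+-monoid : CommutativeMonoid 0ℓ 0ℓ
  ℝ-+-monoid = record { Carrier = ℝ ; _≈_ = _≡_ ; _∙_ = _+_ ; ε = 0ℝ
                      ; isCommutativeMonoid = +-isCommutativeMonoid }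

  open CommutativeMonoidSolver ℝ-+-monoid using (solve; _⊜_; _⊕_)

  withWeight : (E → ℝ) → FullUltraTriple R
  withWeight v = record T { w = v }

  perimeter : (E → ℝ) → List E → ℝ
  perimeter v = PER (withWeight v)

  sumOver : (E → ℝ) → List E → ℝ
  sumOver f l = sumℝ T (map f l)

  -- the weight seen by the remaining choices once a has been chosen
  shift : (E → ℝ) → E → E → ℝ
  shift v a y = v y + d a y

  perimeter-shift : ∀ v a l → perimeter (shift v a) l ≡ sumOver (d a) l + perimeter v l
  perimeter-shift v a [] = sym (+-identityˡ 0ℝ)
  perimeter-shift v a (b ∷ l) =
    trans (cong (λ p → v b + d a b + sumOver (d b) l + p) (perimeter-shift v a l))
      (solve 5 (λ vb dab Sb Sa P → (((vb ⊕ dab) ⊕ Sb) ⊕ (Sa ⊕ P)) ⊜ ((dab ⊕ Sa) ⊕ ((vb ⊕ Sb) ⊕ P)))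
        refl (v b) (d a b) (sumOver (d b) l) (sumOver (d a) l) (perimeter v l))

  perimeter-cons : ∀ v a l → perimeter v (a ∷ l) ≡ v a + perimeter (shift v a) l
  perimeter-cons v a l = trans (+-assoc (v a) _ _) (cong (v a +_) (sym (perimeter-shift v a l)))

  sumOver-insert : ∀ f pre b post → sumOver f (pre ++ b ∷ post) ≡ f b + sumOver f (pre ++ post)
  sumOver-insert f [] b post = refl
  sumOver-insert f (c ∷ pre) b post =
    trans (cong (f c +_) (sumOver-insert f pre b post))
      (solve 3 (λ x y s → (x ⊕ (y ⊕ s)) ⊜ (y ⊕ (x ⊕ s))) refl (f c) (f b) (sumOver f (pre ++ post)))

  perimeter-insert : ∀ v pre b post →
    perimeter v (pre ++ b ∷ post) ≡ v b + sumOver (d b) (pre ++ post) + perimeter v (pre ++ post)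
  perimeter-insert v [] b post = refl
  perimeter-insert v (c ∷ pre) b post = begin
      v c + sumOver (d c) (pre ++ b ∷ post) + perimeter v (pre ++ b ∷ post)
    ≡⟨ cong₂ (λ s p → v c + s + p) (sumOver-insert (d c) pre b post) (perimeter-insert v pre b post) ⟩
      v c + (d c b + sumOver (d c) rest) + (v b + sumOver (d b) rest + perimeter v rest)
    ≡⟨ cong (λ δ → v c + (δ + sumOver (d c) rest) + (v b + sumOver (d b) rest + perimeter v rest)) (d-sym c b) ⟩
      v c + (d b c + sumOver (d c) rest) + (v b + sumOver (d b) rest + perimeter v rest)
    ≡⟨ solve 6 (λ vc δ Sc vb Sb P → ((vc ⊕ (δ ⊕ Sc)) ⊕ ((vb ⊕ Sb) ⊕ P)) ⊜ ((vb ⊕ (δ ⊕ Sb)) ⊕ ((vc ⊕ Sc) ⊕ P)))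
         refl (v c) (d b c) (sumOver (d c) rest) (v b) (sumOver (d b) rest) (perimeter v rest) ⟩
      v b + (d b c + sumOver (d b) rest) + (v c + sumOver (d c) rest + perimeter v rest)
    ∎
    where
      open ≡-Reasoning
      rest = pre ++ post

  perimeter-snoc : ∀ v p x → perimeter v (p ++ [ x ]) ≡ perimeter v p + (v x + sumOver (λ y → d y x) p)
  perimeter-snoc v p x = begin
      perimeter v (p ++ [ x ])
    ≡⟨ perimeter-insert v p x [] ⟩
      v x + sumOver (d x) (p ++ []) + perimeter v (p ++ [])
    ≡⟨ cong (λ q → v x + sumOver (d x) q + perimeter v q) (++-identityʳ p) ⟩
      v x + sumOver (d x) p + perimeter v p
    ≡⟨ cong (λ s → v x + sumℝ T s + perimeter v p) (map-cong (d-sym x) p) ⟩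
      v x + sumOver (λ y → d y x) p + perimeter v p
    ≡⟨ +-comm _ _ ⟩
      perimeter v p + (v x + sumOver (λ y → d y x) p)
    ∎
    where open ≡-Reasoning

  sumOver-mono : ∀ f g l → All (λ y → f y ≤ g y) l → sumOver f l ≤ sumOver g l
  sumOver-mono f g [] [] = reflexive refl
  sumOver-mono f g (y ∷ l) (fy≤gy ∷ rest) = +-mono₂-≤ fy≤gy (sumOver-mono f g l rest)

  closer-dominates : ∀ a b z → d b a ≤ d z a → d b z ≤ d a z
  closer-dominates a b z b-closer with d-ultra b z a
  ... | inj₁ dbz≤dba = subst (d b z ≤_) (d-sym z a) (≤-trans dbz≤dba b-closer)
  ... | inj₂ dbz≤dza = subst (d b z ≤_) (d-sym z a) dbz≤dza

  All-insert : ∀ {Q : E → Set} pre b post → All Q (pre ++ post) → Q b → All Q (pre ++ b ∷ post)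
  All-insert pre b post h Qb = let Qpre , Qpost = ++⁻ pre h in ++⁺ Qpre (Qb ∷ Qpost)

  All-delete : ∀ {Q : E → Set} pre b post → All Q (pre ++ b ∷ post) → Q b × All Q (pre ++ post)
  All-delete pre b post h with ++⁻ pre h
  ... | Qpre , Qb ∷ Qpost = Qb , ++⁺ Qpre Qpost

  length-insert : ∀ (pre : List E) b post → length (pre ++ b ∷ post) ≡ suc (length (pre ++ post))
  length-insert [] b post = refl
  length-insert (c ∷ pre) b post = cong suc (length-insert pre b post)

  record MinimumSplit (f : E → ℝ) (l : List E) : Set where
    constructor minimumSplit
    field
      pre post : List E
      b        : E
      split    : l ≡ pre ++ b ∷ post
      minimal  : All (λ z → f b ≤ f z) (pre ++ post)

  splitAtMinimum : ∀ f y ys → MinimumSplit f (y ∷ ys)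
  splitAtMinimum f y [] = minimumSplit [] [] y refl []
  splitAtMinimum f y (z ∷ zs) with splitAtMinimum f z zs
  ... | minimumSplit pre post b split minimal with total (f y) (f b)
  ...   | inj₁ fy≤fb = minimumSplit [] (z ∷ zs) y refl
            (subst (All _) (sym split)
              (All-insert pre b post (All.map (≤-trans fy≤fb) minimal) fy≤fb))
  ...   | inj₂ fb≤fy = minimumSplit (y ∷ pre) post b (cong (y ∷_) split) (fb≤fy ∷ minimal)

  GreedyList : (E → ℝ) → (E → Set) → List E → Set
  GreedyList v C [] = ⊤
  GreedyList v C (a ∷ as) = C a × (∀ x → C x → v x ≤ v a) × GreedyList (shift v a) C as

  greedy-take : ∀ v C n l → GreedyList v C l → GreedyList v C (take n l)
  greedy-take v C zero l g = tt
  greedy-take v C (suc n) [] g = tt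
  greedy-take v C (suc n) (a ∷ as) (Ca , a-max , g) = Ca , a-max , greedy-take (shift v a) C n as g

  greedy-maximal : ∀ v C l x → GreedyList v C l → All C x → length x ≡ length l →
                   perimeter v x ≤ perimeter v l
  greedy-maximal v C [] [] _ _ _ = reflexive refl
  greedy-maximal v C (a ∷ as) (y ∷ ys) (Ca , a-max , as-greedy) Cx |x|≡|l|
    with splitAtMinimum (λ z → d z a) y ys
  ... | minimumSplit pre post b split closest = begin
      perimeter v (y ∷ ys)                          ≡⟨ cong (perimeter v) split ⟩
      perimeter v (pre ++ b ∷ post)                 ≡⟨ perimeter-insert v pre b post ⟩
      v b + sumOver (d b) rest + perimeter v rest   ≤⟨ +-mono-≤ (perimeter v rest) (+-mono₂-≤ (a-max b Cb) b-to-a) ⟩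
      perimeter v (a ∷ rest)                        ≡⟨ perimeter-cons v a rest ⟩
      v a + perimeter (shift v a) rest              ≤⟨ +-monoʳ-≤ (v a) rest≤as ⟩
      v a + perimeter (shift v a) as                ≡⟨ sym (perimeter-cons v a as) ⟩
      perimeter v (a ∷ as)                          ∎
    where
      open PosetReasoning ℝ-poset
      rest = pre ++ post
      b-to-a : sumOver (d b) rest ≤ sumOver (d a) rest
      b-to-a = sumOver-mono (d b) (d a) rest (All.map (closer-dominates a b _) closest)
      Cb-rest : C b × All C rest
      Cb-rest = All-delete pre b post (subst (All C) split Cx)
      Cb : C b
      Cb = proj₁ Cb-rest
      |rest|≡|as| : length rest ≡ length as
      |rest|≡|as| = suc-injective (trans (sym (length-insert pre b post)) (trans (cong length (sym split)) |x|≡|l|))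
      rest≤as : perimeter (shift v a) rest ≤ perimeter (shift v a) as
      rest≤as = greedy-maximal (shift v a) C as rest as-greedy (proj₂ Cb-rest) |rest|≡|as|

  greedyList : ∀ v C {m} (c : Vec E m) → IsGreedy (withWeight v) C m c → GreedyList v C (toList c)
  greedyList v C [] _ = tt
  greedyList v C (a ∷ c) (C-c , c-greedy) =
    C-c Fin.zero , head-max , greedyList (shift v a) C c ((λ i → C-c (Fin.suc i)) , tail-greedy)
    where
      u+0+0 : ∀ u → u + 0ℝ + 0ℝ ≡ u
      u+0+0 u = trans (+-identityʳ _) (+-identityʳ u)
      head-max : ∀ x → C x → v x ≤ v a
      head-max x Cx = subst₂ _≤_ (u+0+0 (v x)) (u+0+0 (v a)) (c-greedy Fin.zero x Cx)
      -- the first point contributes the same v a on both sides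
      tail-greedy : ∀ i x → C x →
        perimeter (shift v a) (take (toℕ i) (toList c) ++ [ x ]) ≤
        perimeter (shift v a) (take (suc (toℕ i)) (toList c))
      tail-greedy i x Cx = +-cancelˡ-≤ (v a)
        (subst₂ _≤_ (perimeter-cons v a (take (toℕ i) (toList c) ++ [ x ]))
                    (perimeter-cons v a (take (suc (toℕ i)) (toList c))) (c-greedy (Fin.suc i) x Cx))

  prefix-suc : ∀ {m} (c : Vec E m) k →
    take (suc (toℕ k)) (toList c) ≡ take (toℕ k) (toList c) ++ [ lookup c k ]
  prefix-suc (a ∷ c) Fin.zero = refl
  prefix-suc (a ∷ c) (Fin.suc k) = cong (a ∷_) (prefix-suc c k)

  prefix-length : ∀ {m} (c : Vec E m) n → length (take n (toList c)) ≡ n ⊓ m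
  prefix-length c n = trans (length-take n (toList c)) (cong (n ⊓_) (length-toList c))

  greedy-prefix-perimeter : ∀ C {m} (c c′ : Vec E m) → IsGreedy T C m c → IsGreedy T C m c′ →
    ∀ n → perimeter w (take n (toList c)) ≡ perimeter w (take n (toList c′))
  greedy-prefix-perimeter C {m} c c′ g g′ n = ≤-antisym (bounded-by c c′ g g′) (bounded-by c′ c g′ g)
    where
      bounded-by : ∀ (c c′ : Vec E m) → IsGreedy T C m c → IsGreedy T C m c′ →
        perimeter w (take n (toList c)) ≤ perimeter w (take n (toList c′))
      bounded-by c c′ (C-c , _) g′ =
        greedy-maximal w C (take n (toList c′)) (take n (toList c))
          (greedy-take w C n (toList c′) (greedyList w C c′ g′))
          (take⁺ n (toList⁺ (lookup⁻ C-c)))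
          (trans (prefix-length c n) (sym (prefix-length c′ n)))

  prefix-gain : ∀ {m} (c : Vec E m) k →
    perimeter w (take (toℕ k) (toList c)) + gain T c k ≡ perimeter w (take (suc (toℕ k)) (toList c))
  prefix-gain c k = trans (sym (perimeter-snoc w (take (toℕ k) (toList c)) (lookup c k))) (cong (perimeter w) (sym (prefix-suc c k)))

corollary8p8 : (R : RealField) (T : FullUltraTriple R) →
    (C : FullUltraTriple.E T → Set) (m : ℕ) (k : Fin m) →
    (c c′ : Vec (FullUltraTriple.E T) m) →
    IsGreedy T C m c → IsGreedy T C m c′ →
    gain T c k ≡ gain T c′ k
corollary8p8 R T C m k c c′ g g′ = +-cancelˡ-≡ (Pₖ c) (begin
    Pₖ c + gain T c k    ≡⟨ prefix-gain c k ⟩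
    Pₖ₊₁ c               ≡⟨ greedy-prefix-perimeter C c c′ g g′ (suc (toℕ k)) ⟩
    Pₖ₊₁ c′              ≡⟨ sym (prefix-gain c′ k) ⟩
    Pₖ c′ + gain T c′ k  ≡⟨ cong (_+ gain T c′ k) (sym (greedy-prefix-perimeter C c c′ g g′ (toℕ k))) ⟩
    Pₖ c + gain T c′ k   ∎)
  where
    open RealField R using (_+_)
    open FullUltraTriple T using (E; w)
    open OrderedAddition R using (+-cancelˡ-≡)
    open GreedyPerimeter R T
    open ≡-Reasoning
    Pₖ Pₖ₊₁ : Vec E m → RealField.ℝ R
    Pₖ c = perimeter w (take (toℕ k) (toList c))
    Pₖ₊₁ c = perimeter w (take (suc (toℕ k)) (toList c))
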